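{- Let $r$, $s$ and $m$ be arbitrary integers with $r\neq 0$. Then for each non-negative integer $n$, \[ \sum_{k = 0}^n (-1)^{k(s+1)} \binom {n}{k}^2 \Big (\frac{F_s}{F_r}\Big )^k F_{(r+s)k+m} = \sum_{k = 0}^n (-1)^{(s+1)(n-k)} \binom {n}{k} \binom {n+k}{k} \Big (\frac{F_{r+s}}{F_r}\Big )^{n-k} F_{s(n-k)+m}, \] \[ \sum_{k = 0}^n (-1)^{k(s+1)} \binom {n}{k}^2 \Big (\frac{F_s}{F_r}\Big )^k L_{(r+s)k+m} = \sum_{k = 0}^n (-1)^{(s+1)(n-k)} \binom {n}{k} \binom {n+k}{k} \Big (\frac{F_{r+s}}{F_r}\Big )^{n-k} L_{s(n-k)+m}. \]
   Context: $F_j$ and $L_j$ denote the Fibonacci and Lucas numbers: $F_0=0,F_1=1$, $L_0=2,L_1=1$, both satisfying $X_j=X_{j-1}+X_{j-2}$, extended to all integer indices via the recurrence (so $F_{ -j}=(-1)^{j+1}F_j$, $L_{ -j}=(-1)^jL_j$). -}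

module Defs where

open import Data.Nat as ℕ using (ℕ; zero; suc)
open import Data.Nat.Combinatorics using (_C_)
open import Data.Integer as ℤ using (ℤ; +_; -[1+_])
open import Data.Rational as ℚ using (ℚ; 0ℚ; 1ℚ; _÷_; ≢-nonZero)
open import Data.Rational.Properties as ℚP using ()
open import Relation.Nullary using (yes; no)

fibℕ : ℕ → ℕ
fibℕ zero = 0
fibℕ (suc zero) = 1
fibℕ (suc (suc n)) = fibℕ (suc n) ℕ.+ fibℕ n

lucℕ : ℕ → ℕ
lucℕ zero = 2
lucℕ (suc zero) = 1
lucℕ (suc (suc n)) = lucℕ (suc n) ℕ.+ lucℕ n

signℤ : ℕ → ℤ
signℤ zero = + 1
signℤ (suc n) = ℤ.- signℤ n

-- Extension to all integer indices:
-- F_{-j} = (-1)^{j+1} F_j,  L_{-j} = (-1)^j L_j   (here j = n+1)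
F : ℤ → ℤ
F (+ n) = + fibℕ n
F -[1+ n ] = signℤ n ℤ.* + fibℕ (suc n)

L : ℤ → ℤ
L (+ n) = + lucℕ n
L -[1+ n ] = signℤ (suc n) ℤ.* + lucℕ (suc n)

-- (-1)^z for an integer exponent z (depends only on parity of z)
negOnePow : ℤ → ℚ
negOnePow z = (signℤ ℤ.∣ z ∣) ℚ./ 1

_^ℚ_ : ℚ → ℕ → ℚ
p ^ℚ zero = 1ℚ
p ^ℚ suc n = p ℚ.* (p ^ℚ n)

-- division of rationals (only ever applied to a nonzero denominator in the
-- theorem; returns 0 for a zero denominator to be total)
_/ℚ_ : ℚ → ℚ → ℚ
p /ℚ q with q ℚP.≟ 0ℚ
... | yes _ = 0ℚ
... | no q≢0 = _÷_ p q {{≢-nonZero q≢0}}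

sumTo : ℕ → (ℕ → ℚ) → ℚ
sumTo zero f = f 0
sumTo (suc n) f = sumTo n f ℚ.+ f (suc n)

ℕtoℚ : ℕ → ℚ
ℕtoℚ n = (+ n) ℚ./ 1

Fℚ : ℤ → ℚ
Fℚ z = (F z) ℚ./ 1

Lℚ : ℤ → ℚ
Lℚ z = (L z) ℚ./ 1

lhs : (ℤ → ℚ) → ℤ → ℤ → ℤ → ℕ → ℚ
lhs X r s m n = sumTo n λ k →
  negOnePow (+ k ℤ.* (s ℤ.+ + 1))
  ℚ.* (ℕtoℚ (n C k) ℚ.* ℕtoℚ (n C k))
  ℚ.* ((Fℚ s /ℚ Fℚ r) ^ℚ k)
  ℚ.* X ((r ℤ.+ s) ℤ.* + k ℤ.+ m)

rhs : (ℤ → ℚ) → ℤ → ℤ → ℤ → ℕ → ℚ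
rhs X r s m n = sumTo n λ k →
  negOnePow ((s ℤ.+ + 1) ℤ.* + (n ℕ.∸ k))
  ℚ.* (ℕtoℚ (n C k) ℚ.* ℕtoℚ ((n ℕ.+ k) C k))
  ℚ.* ((Fℚ (r ℤ.+ s) /ℚ Fℚ r) ^ℚ (n ℕ.∸ k))
  ℚ.* X (s ℤ.* + (n ℕ.∸ k) ℤ.+ m)

module Submission where

open import Defs
open import Data.Nat using (ℕ)
open import Data.Integer using (ℤ; +_)
open import Data.Product using (_×_)
open import Relation.Binary.PropositionalEquality using (_≡_; _≢_)

open import Data.Nat as ℕ using (zero; suc; z≤n; s≤s; _!)
import Data.Nat.Properties as ℕP
open import Data.Nat.Combinatorics
  using (_C_; nCk≡nC[n∸k]; k>n⇒nCk≡0; nCk+nC[k+1]≡[n+1]C[k+1]; nCk≡n!/k![n-k]!; k![n∸k]!∣n!)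
open import Data.Nat.Coprimality using (1-coprimeTo) renaming (sym to coprime-sym)
open import Data.Nat.DivMod using (m/n*n≡m)
import Data.Nat.Tactic.RingSolver as ℕ-Solver
open import Data.Integer as ℤ using (+[1+_]; -[1+_])
import Data.Integer.Properties as ℤP
import Data.Integer.Tactic.RingSolver as ℤ-Solver
open import Data.Rational as ℚ using (ℚ; mkℚ; 0ℚ; 1ℚ; _+_; _*_; -_)
import Data.Rational.Properties as ℚP
import Data.Rational.Solver as ℚ-Solver
open import Data.Product using (_,_; proj₁)
open import Data.Sum using (inj₁; inj₂; [_,_])
open import Data.Empty using (⊥-elim)
open import Function using (_∘_)
open import Relation.Nullary using (yes; no)
open import Relation.Binary.PropositionalEquality using (refl; sym; trans; cong; cong₂; subst; module ≡-Reasoning)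
import Algebra.Properties.Group as GroupProperties

open GroupProperties ℚP.+-0-group using () renaming (∙-cancelˡ to +-cancelˡ; ⁻¹-involutive to neg-involutive)
open ℚ-Solver.+-*-Solver using (solve; _:=_; _:+_; _:*_; _:-_; :-_; con)

-- With τ = (-1)^(s+1), c = τ F_s / F_r and d = τ F_(r+s) / F_r, Vajda's identity
-- X_(j+s) F_(r+s) = F_s X_(j+r+s) + (-1)^s F_r X_j, valid for every sequence X satisfying
-- the Fibonacci recurrence (in particular F and L), says c X_(j+r+s) = X_j + d X_(j+s): in terms
-- of the shift operator E, c E^(r+s) = 1 + d E^s. Raising this to the k-th power gives
-- c^k X_((r+s)k+m) = Σ_i C(k,i) d^i X_(si+m). Substituting into the left-hand side and
-- exchanging the sums, the coefficient of d^i X_(si+m) is Σ_k C(n,k)² C(k,i) = C(n,i) C(2n-i,n)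
-- (Vandermonde's convolution), which is the right-hand side read backwards.

fromℤ : ℤ → ℚ
fromℤ z = z ℚ./ 1

private
  fromℤ-as-mkℚ : ∀ z → fromℤ z ≡ mkℚ z 0 (coprime-sym (1-coprimeTo ℤ.∣ z ∣))
  fromℤ-as-mkℚ z = ℚP.↥p/↧p≡p (mkℚ z 0 (coprime-sym (1-coprimeTo ℤ.∣ z ∣)))

fromℤ-homo-+ : ∀ a b → fromℤ (a ℤ.+ b) ≡ fromℤ a + fromℤ b
fromℤ-homo-+ a b = begin
  fromℤ (a ℤ.+ b)                                ≡⟨ cong fromℤ (cong₂ ℤ._+_ (ℤP.*-identityʳ a) (ℤP.*-identityʳ b)) ⟨
  fromℤ (a ℤ.* + 1 ℤ.+ b ℤ.* + 1)                ≡⟨ cong₂ _+_ (fromℤ-as-mkℚ a) (fromℤ-as-mkℚ b) ⟨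
  fromℤ a + fromℤ b                              ∎
  where open ≡-Reasoning

fromℤ-homo-* : ∀ a b → fromℤ (a ℤ.* b) ≡ fromℤ a * fromℤ b
fromℤ-homo-* a b = sym (cong₂ _*_ (fromℤ-as-mkℚ a) (fromℤ-as-mkℚ b))

fromℤ-homo-neg : ∀ z → fromℤ (ℤ.- z) ≡ - fromℤ z
fromℤ-homo-neg z = trans (fromℤ-as-mkℚ (ℤ.- z)) (trans (mkℚ-neg z) (cong -_ (sym (fromℤ-as-mkℚ z))))
  where
  mkℚ-neg : ∀ z → mkℚ (ℤ.- z) 0 (coprime-sym (1-coprimeTo ℤ.∣ ℤ.- z ∣)) ≡ - mkℚ z 0 (coprime-sym (1-coprimeTo ℤ.∣ z ∣))
  mkℚ-neg (+ zero)  = refl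
  mkℚ-neg +[1+ n ] = refl
  mkℚ-neg -[1+ n ] = refl

fromℤ-injective : ∀ {a b} → fromℤ a ≡ fromℤ b → a ≡ b
fromℤ-injective {a} {b} eq = cong ℚ.↥_ (trans (sym (fromℤ-as-mkℚ a)) (trans eq (fromℤ-as-mkℚ b)))

ℕtoℚ-homo-+ : ∀ a b → ℕtoℚ (a ℕ.+ b) ≡ ℕtoℚ a + ℕtoℚ b
ℕtoℚ-homo-+ a b = trans (cong fromℤ (ℤP.pos-+ a b)) (fromℤ-homo-+ (+ a) (+ b))

ℕtoℚ-homo-* : ∀ a b → ℕtoℚ (a ℕ.* b) ≡ ℕtoℚ a * ℕtoℚ b
ℕtoℚ-homo-* a b = trans (cong fromℤ (ℤP.pos-* a b)) (fromℤ-homo-* (+ a) (+ b))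

/ℚ-as-* : ∀ p q → q ≢ 0ℚ → p /ℚ q ≡ p * (1ℚ /ℚ q)
/ℚ-as-* p q q≢0 with q ℚP.≟ 0ℚ
... | yes q≡0 = ⊥-elim (q≢0 q≡0)
... | no _    = cong (p *_) (sym (ℚP.*-identityˡ _))

1/ℚ-inverseˡ : ∀ q → q ≢ 0ℚ → (1ℚ /ℚ q) * q ≡ 1ℚ
1/ℚ-inverseˡ q q≢0 with q ℚP.≟ 0ℚ
... | yes q≡0 = ⊥-elim (q≢0 q≡0)
... | no _    = trans (cong (_* q) (ℚP.*-identityˡ (ℚ.1/_ q {{ℚ.≢-nonZero q≢0}}))) (ℚP.*-inverseˡ q {{ℚ.≢-nonZero q≢0}})

signℤ-+ : ∀ a b → signℤ (a ℕ.+ b) ≡ signℤ a ℤ.* signℤ b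
signℤ-+ zero    b = sym (ℤP.*-identityˡ (signℤ b))
signℤ-+ (suc a) b = trans (cong ℤ.-_ (signℤ-+ a b)) (ℤP.neg-distribˡ-* (signℤ a) (signℤ b))

signℤ-square : ∀ a → signℤ a ℤ.* signℤ a ≡ + 1
signℤ-square zero    = refl
signℤ-square (suc a) = trans (neg*neg (signℤ a)) (signℤ-square a)
  where
  neg*neg : ∀ x → ℤ.- x ℤ.* ℤ.- x ≡ x ℤ.* x
  neg*neg = ℤ-Solver.solve-∀

negOnePow-suc : ∀ z → negOnePow (z ℤ.+ + 1) ≡ - negOnePow z
negOnePow-suc (+ n) = trans (cong (λ k → fromℤ (signℤ k)) (ℕP.+-comm n 1)) (fromℤ-homo-neg (signℤ n))
negOnePow-suc -[1+ zero ]  = refl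
negOnePow-suc -[1+ suc n ] =
  sym (trans (cong -_ (fromℤ-homo-neg (signℤ (suc n)))) (neg-involutive (negOnePow -[1+ n ])))

negOnePow-square : ∀ z → negOnePow z * negOnePow z ≡ 1ℚ
negOnePow-square z = trans (sym (fromℤ-homo-* (signℤ ℤ.∣ z ∣) (signℤ ℤ.∣ z ∣))) (cong fromℤ (signℤ-square ℤ.∣ z ∣))

negOnePow-* : ∀ k z → negOnePow (+ k ℤ.* z) ≡ negOnePow z ^ℚ k
negOnePow-* k z = trans (cong (λ n → fromℤ (signℤ n)) (ℤP.abs-* (+ k) z)) (power k)
  where
  power : ∀ k → fromℤ (signℤ (k ℕ.* ℤ.∣ z ∣)) ≡ negOnePow z ^ℚ k
  power zero    = refl
  power (suc k) = begin
    fromℤ (signℤ (ℤ.∣ z ∣ ℕ.+ k ℕ.* ℤ.∣ z ∣))            ≡⟨ cong fromℤ (signℤ-+ ℤ.∣ z ∣ (k ℕ.* ℤ.∣ z ∣)) ⟩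
    fromℤ (signℤ ℤ.∣ z ∣ ℤ.* signℤ (k ℕ.* ℤ.∣ z ∣))      ≡⟨ fromℤ-homo-* (signℤ ℤ.∣ z ∣) _ ⟩
    negOnePow z * fromℤ (signℤ (k ℕ.* ℤ.∣ z ∣))         ≡⟨ cong (negOnePow z *_) (power k) ⟩
    negOnePow z * negOnePow z ^ℚ k                      ∎
    where open ≡-Reasoning

^ℚ-distrib-* : ∀ p q k → (p * q) ^ℚ k ≡ p ^ℚ k * q ^ℚ k
^ℚ-distrib-* p q zero    = refl
^ℚ-distrib-* p q (suc k) = trans (cong ((p * q) *_) (^ℚ-distrib-* p q k)) (interchange p q (p ^ℚ k) (q ^ℚ k))
  where
  interchange : ∀ a b c d → (a * b) * (c * d) ≡ (a * c) * (b * d)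
  interchange = solve 4 (λ a b c d → (a :* b) :* (c :* d) := (a :* c) :* (b :* d)) refl

-- Finite sums

+-interchange : ∀ a b c d → (a + b) + (c + d) ≡ (a + c) + (b + d)
+-interchange = solve 4 (λ a b c d → (a :+ b) :+ (c :+ d) := (a :+ c) :+ (b :+ d)) refl

sum-cong : ∀ n {f g : ℕ → ℚ} → (∀ i → i ℕ.≤ n → f i ≡ g i) → sumTo n f ≡ sumTo n g
sum-cong zero    eq = eq 0 z≤n
sum-cong (suc n) eq =
  cong₂ _+_ (sum-cong n (λ i i≤n → eq i (ℕP.m≤n⇒m≤1+n i≤n))) (eq (suc n) ℕP.≤-refl)

sum-+ : ∀ n (f g : ℕ → ℚ) → sumTo n (λ i → f i + g i) ≡ sumTo n f + sumTo n g
sum-+ zero    f g = refl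
sum-+ (suc n) f g = trans (cong (_+ (f (suc n) + g (suc n))) (sum-+ n f g))
  (+-interchange (sumTo n f) (sumTo n g) (f (suc n)) (g (suc n)))

*-distribˡ-sum : ∀ n a (f : ℕ → ℚ) → a * sumTo n f ≡ sumTo n (λ i → a * f i)
*-distribˡ-sum zero    a f = refl
*-distribˡ-sum (suc n) a f =
  trans (ℚP.*-distribˡ-+ a (sumTo n f) (f (suc n))) (cong (_+ a * f (suc n)) (*-distribˡ-sum n a f))

*-distribʳ-sum : ∀ n a (f : ℕ → ℚ) → sumTo n f * a ≡ sumTo n (λ i → f i * a)
*-distribʳ-sum n a f = trans (ℚP.*-comm (sumTo n f) a)
  (trans (*-distribˡ-sum n a f) (sum-cong n (λ i _ → ℚP.*-comm a (f i))))

sum-suc : ∀ n (f : ℕ → ℚ) → sumTo (suc n) f ≡ f 0 + sumTo n (λ i → f (suc i))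
sum-suc zero    f = refl
sum-suc (suc n) f = trans (cong (_+ f (suc (suc n))) (sum-suc n f)) (ℚP.+-assoc (f 0) _ _)

sum-swap : ∀ n p (f : ℕ → ℕ → ℚ) →
  sumTo n (λ k → sumTo p (f k)) ≡ sumTo p (λ i → sumTo n (λ k → f k i))
sum-swap zero    p f = refl
sum-swap (suc n) p f = trans (cong (_+ sumTo p (f (suc n))) (sum-swap n p f))
  (sym (sum-+ p (λ i → sumTo n (λ k → f k i)) (f (suc n))))

sum-reverse : ∀ n (f : ℕ → ℚ) → sumTo n f ≡ sumTo n (λ i → f (n ℕ.∸ i))
sum-reverse zero    f = refl
sum-reverse (suc n) f = begin
  sumTo n f + f (suc n)                       ≡⟨ cong (_+ f (suc n)) (sum-reverse n f) ⟩
  sumTo n (λ i → f (n ℕ.∸ i)) + f (suc n)     ≡⟨ ℚP.+-comm _ (f (suc n)) ⟩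
  f (suc n) + sumTo n (λ i → f (n ℕ.∸ i))     ≡⟨ sum-suc n (λ i → f (suc n ℕ.∸ i)) ⟨
  sumTo (suc n) (λ i → f (suc n ℕ.∸ i))       ∎
  where open ≡-Reasoning

sum-extend : ∀ k n (f : ℕ → ℚ) → k ℕ.≤ n → (∀ i → k ℕ.< i → f i ≡ 0ℚ) → sumTo k f ≡ sumTo n f
sum-extend k zero    f z≤n vanish = refl
sum-extend k (suc n) f k≤1+n vanish with ℕP.m≤n⇒m<n∨m≡n k≤1+n
... | inj₂ refl = refl
... | inj₁ k<1+n = begin
  sumTo k f                ≡⟨ sum-extend k n f (ℕP.≤-pred k<1+n) vanish ⟩
  sumTo n f                ≡⟨ ℚP.+-identityʳ (sumTo n f) ⟨
  sumTo n f + 0ℚ           ≡⟨ cong (_+_ (sumTo n f)) (vanish (suc n) k<1+n) ⟨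
  sumTo n f + f (suc n)    ∎
  where open ≡-Reasoning

sum-drop : ∀ i n (f : ℕ → ℚ) → i ℕ.≤ n → (∀ k → k ℕ.< i → f k ≡ 0ℚ) →
  sumTo n f ≡ sumTo (n ℕ.∸ i) (λ j → f (i ℕ.+ j))
sum-drop zero    n       f i≤n       vanish = refl
sum-drop (suc i) (suc n) f (s≤s i≤n) vanish = begin
  sumTo (suc n) f                                 ≡⟨ sum-suc n f ⟩
  f 0 + sumTo n (λ j → f (suc j))                 ≡⟨ cong (_+ sumTo n (λ j → f (suc j))) (vanish 0 (s≤s z≤n)) ⟩
  0ℚ + sumTo n (λ j → f (suc j))                  ≡⟨ ℚP.+-identityˡ _ ⟩
  sumTo n (λ j → f (suc j))                       ≡⟨ sum-drop i n (λ j → f (suc j)) i≤n (λ k k<i → vanish (suc k) (s≤s k<i)) ⟩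
  sumTo (n ℕ.∸ i) (λ j → f (suc (i ℕ.+ j)))       ∎
  where open ≡-Reasoning

-- Binomial coefficients

binom : ℕ → ℕ → ℚ
binom n k = ℕtoℚ (n C k)

nCk*[k!*[n∸k]!]≡n! : ∀ {n k} → k ℕ.≤ n → (n C k) ℕ.* (k ! ℕ.* (n ℕ.∸ k) !) ≡ n !
nCk*[k!*[n∸k]!]≡n! {n} {k} k≤n =
  trans (cong (ℕ._* (k ! ℕ.* (n ℕ.∸ k) !)) (nCk≡n!/k![n-k]! k≤n))
        (m/n*n≡m {{ℕP._!*_!≢0 k (n ℕ.∸ k)}} (k![n∸k]!∣n! k≤n))

nC[i+j]*[i+j]Ci≡nCi*[n∸i]Cj : ∀ {n} i j → i ℕ.+ j ℕ.≤ n →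
  (n C (i ℕ.+ j)) ℕ.* ((i ℕ.+ j) C i) ≡ (n C i) ℕ.* ((n ℕ.∸ i) C j)
nC[i+j]*[i+j]Ci≡nCi*[n∸i]Cj {n} i j i+j≤n =
  ℕP.*-cancelʳ-≡ _ _ (i ! ℕ.* (j ! ℕ.* l !)) {{ℕP.m*n≢0 (i !) _ {{i !≢0}} {{j !* l !≢0}}}}
    (trans lhs≡n! (sym rhs≡n!))
  where
  open ℕP using (_!≢0; _!*_!≢0)
  open ≡-Reasoning
  l = n ℕ.∸ (i ℕ.+ j)
  i≤n = ℕP.m+n≤o⇒m≤o i i+j≤n
  regroupˡ : ∀ x y a b c → x ℕ.* y ℕ.* (a ℕ.* (b ℕ.* c)) ≡ x ℕ.* (y ℕ.* (a ℕ.* b) ℕ.* c)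
  regroupˡ = ℕ-Solver.solve-∀
  regroupʳ : ∀ x y a b c → x ℕ.* y ℕ.* (a ℕ.* (b ℕ.* c)) ≡ x ℕ.* (a ℕ.* (y ℕ.* (b ℕ.* c)))
  regroupʳ = ℕ-Solver.solve-∀
  lhs≡n! : (n C (i ℕ.+ j)) ℕ.* ((i ℕ.+ j) C i) ℕ.* (i ! ℕ.* (j ! ℕ.* l !)) ≡ n !
  lhs≡n! = begin
    (n C (i ℕ.+ j)) ℕ.* ((i ℕ.+ j) C i) ℕ.* (i ! ℕ.* (j ! ℕ.* l !))
      ≡⟨ regroupˡ (n C (i ℕ.+ j)) ((i ℕ.+ j) C i) (i !) (j !) (l !) ⟩
    (n C (i ℕ.+ j)) ℕ.* (((i ℕ.+ j) C i) ℕ.* (i ! ℕ.* j !) ℕ.* l !)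
      ≡⟨ cong (λ x → (n C (i ℕ.+ j)) ℕ.* (((i ℕ.+ j) C i) ℕ.* (i ! ℕ.* x !) ℕ.* l !)) (ℕP.m+n∸m≡n i j) ⟨
    (n C (i ℕ.+ j)) ℕ.* (((i ℕ.+ j) C i) ℕ.* (i ! ℕ.* (i ℕ.+ j ℕ.∸ i) !) ℕ.* l !)
      ≡⟨ cong (λ x → (n C (i ℕ.+ j)) ℕ.* (x ℕ.* l !)) (nCk*[k!*[n∸k]!]≡n! (ℕP.m≤m+n i j)) ⟩
    (n C (i ℕ.+ j)) ℕ.* ((i ℕ.+ j) ! ℕ.* l !)
      ≡⟨ nCk*[k!*[n∸k]!]≡n! i+j≤n ⟩
    n ! ∎
  rhs≡n! : (n C i) ℕ.* ((n ℕ.∸ i) C j) ℕ.* (i ! ℕ.* (j ! ℕ.* l !)) ≡ n !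
  rhs≡n! = begin
    (n C i) ℕ.* ((n ℕ.∸ i) C j) ℕ.* (i ! ℕ.* (j ! ℕ.* l !))
      ≡⟨ regroupʳ (n C i) ((n ℕ.∸ i) C j) (i !) (j !) (l !) ⟩
    (n C i) ℕ.* (i ! ℕ.* (((n ℕ.∸ i) C j) ℕ.* (j ! ℕ.* l !)))
      ≡⟨ cong (λ x → (n C i) ℕ.* (i ! ℕ.* (((n ℕ.∸ i) C j) ℕ.* (j ! ℕ.* x !)))) (ℕP.∸-+-assoc n i j) ⟨
    (n C i) ℕ.* (i ! ℕ.* (((n ℕ.∸ i) C j) ℕ.* (j ! ℕ.* (n ℕ.∸ i ℕ.∸ j) !)))
      ≡⟨ cong (λ x → (n C i) ℕ.* (i ! ℕ.* x)) (nCk*[k!*[n∸k]!]≡n! (ℕP.m+n≤o⇒m≤o∸n j (ℕP.≤-trans (ℕP.≤-reflexive (ℕP.+-comm j i)) i+j≤n))) ⟩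
    (n C i) ℕ.* (i ! ℕ.* (n ℕ.∸ i) !)
      ≡⟨ nCk*[k!*[n∸k]!]≡n! i≤n ⟩
    n ! ∎

binom-pascal : ∀ n k → binom (suc n) (suc k) ≡ binom n k + binom n (suc k)
binom-pascal n k = trans (cong ℕtoℚ (sym (nCk+nC[k+1]≡[n+1]C[k+1] n k))) (ℕtoℚ-homo-+ (n C k) (n C suc k))

binom-vanish : ∀ {n k} → n ℕ.< k → binom n k ≡ 0ℚ
binom-vanish n<k = cong ℕtoℚ (k>n⇒nCk≡0 n<k)

sum-binom-pascal : ∀ k p (g : ℕ → ℚ) →
  sumTo (suc p) (λ i → binom (suc k) i * g i)
    ≡ sumTo (suc p) (λ i → binom k i * g i) + sumTo p (λ i → binom k i * g (suc i))
sum-binom-pascal k p g = begin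
  sumTo (suc p) (λ i → binom (suc k) i * g i)
    ≡⟨ sum-suc p _ ⟩
  g₀ + sumTo p (λ i → binom (suc k) (suc i) * g (suc i))
    ≡⟨ cong (_+_ g₀) (sum-cong p (λ i _ → trans (cong (_* g (suc i)) (binom-pascal k i))
                                               (ℚP.*-distribʳ-+ (g (suc i)) (binom k i) (binom k (suc i))))) ⟩
  g₀ + sumTo p (λ i → binom k i * g (suc i) + binom k (suc i) * g (suc i))
    ≡⟨ cong (_+_ g₀) (sum-+ p _ _) ⟩
  g₀ + (S + S′)
    ≡⟨ rearrange g₀ S S′ ⟩
  (g₀ + S′) + S
    ≡⟨ cong (_+ S) (sum-suc p _) ⟨
  sumTo (suc p) (λ i → binom k i * g i) + S ∎
  where
  open ≡-Reasoning
  g₀ = binom k 0 * g 0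
  S = sumTo p (λ i → binom k i * g (suc i))
  S′ = sumTo p (λ i → binom k (suc i) * g (suc i))
  rearrange : ∀ a b c → a + (b + c) ≡ (a + c) + b
  rearrange = solve 3 (λ a b c → a :+ (b :+ c) := (a :+ c) :+ b) refl

sum-binom-extend : ∀ {k n} (f : ℕ → ℚ) → k ℕ.≤ n → sumTo k (λ i → binom k i * f i) ≡ sumTo n (λ i → binom k i * f i)
sum-binom-extend {k} {n} f k≤n =
  sum-extend k n _ k≤n (λ i k<i → trans (cong (_* f i) (binom-vanish k<i)) (ℚP.*-zeroˡ (f i)))

vandermonde : ∀ a b p → sumTo p (λ k → binom a k * binom b (p ℕ.∸ k)) ≡ binom (a ℕ.+ b) p
vandermonde zero    b p = begin
  sumTo p (λ k → binom 0 k * binom b (p ℕ.∸ k))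
    ≡⟨ sum-extend 0 p _ z≤n (λ k 0<k → trans (cong (_* binom b (p ℕ.∸ k)) (binom-vanish 0<k))
                                              (ℚP.*-zeroˡ (binom b (p ℕ.∸ k)))) ⟨
  binom 0 0 * binom b p
    ≡⟨ ℚP.*-identityˡ (binom b p) ⟩
  binom b p ∎
  where open ≡-Reasoning
vandermonde (suc a) b zero    = refl
vandermonde (suc a) b (suc p) = begin
  sumTo (suc p) (λ k → binom (suc a) k * binom b (suc p ℕ.∸ k))
    ≡⟨ sum-binom-pascal a p (λ k → binom b (suc p ℕ.∸ k)) ⟩
  sumTo (suc p) (λ k → binom a k * binom b (suc p ℕ.∸ k)) + sumTo p (λ k → binom a k * binom b (p ℕ.∸ k))
    ≡⟨ cong₂ _+_ (vandermonde a b (suc p)) (vandermonde a b p) ⟩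
  binom (a ℕ.+ b) (suc p) + binom (a ℕ.+ b) p
    ≡⟨ ℚP.+-comm (binom (a ℕ.+ b) (suc p)) (binom (a ℕ.+ b) p) ⟩
  binom (a ℕ.+ b) p + binom (a ℕ.+ b) (suc p)
    ≡⟨ binom-pascal (a ℕ.+ b) p ⟨
  binom (suc a ℕ.+ b) (suc p) ∎
  where open ≡-Reasoning

binom-subset-of-subset : ∀ {n} i j → i ℕ.+ j ℕ.≤ n →
  binom n (i ℕ.+ j) * binom (i ℕ.+ j) i ≡ binom n i * binom (n ℕ.∸ i) j
binom-subset-of-subset {n} i j i+j≤n = begin
  binom n (i ℕ.+ j) * binom (i ℕ.+ j) i     ≡⟨ ℕtoℚ-homo-* (n C (i ℕ.+ j)) ((i ℕ.+ j) C i) ⟨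
  ℕtoℚ ((n C (i ℕ.+ j)) ℕ.* ((i ℕ.+ j) C i)) ≡⟨ cong ℕtoℚ (nC[i+j]*[i+j]Ci≡nCi*[n∸i]Cj i j i+j≤n) ⟩
  ℕtoℚ ((n C i) ℕ.* ((n ℕ.∸ i) C j))         ≡⟨ ℕtoℚ-homo-* (n C i) ((n ℕ.∸ i) C j) ⟩
  binom n i * binom (n ℕ.∸ i) j              ∎
  where open ≡-Reasoning

binom-symmetric : ∀ {n k} → k ℕ.≤ n → binom n k ≡ binom n (n ℕ.∸ k)
binom-symmetric k≤n = cong ℕtoℚ (nCk≡nC[n∸k] k≤n)

sum-binom²-binom : ∀ {n i} → i ℕ.≤ n →
  sumTo n (λ k → binom n k * binom n k * binom k i) ≡ binom n (n ℕ.∸ i) * binom (n ℕ.+ (n ℕ.∸ i)) (n ℕ.∸ i)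
sum-binom²-binom {n} {i} i≤n = begin
  sumTo n (λ k → binom n k * binom n k * binom k i)
    ≡⟨ sum-drop i n _ i≤n (λ k k<i → trans (cong (_*_ (binom n k * binom n k)) (binom-vanish k<i))
                                             (ℚP.*-zeroʳ (binom n k * binom n k))) ⟩
  sumTo (n ℕ.∸ i) (λ j → binom n (i ℕ.+ j) * binom n (i ℕ.+ j) * binom (i ℕ.+ j) i)
    ≡⟨ sum-cong (n ℕ.∸ i) term ⟩
  sumTo (n ℕ.∸ i) (λ j → binom n i * (binom (n ℕ.∸ i) j * binom n (n ℕ.∸ i ℕ.∸ j)))
    ≡⟨ *-distribˡ-sum (n ℕ.∸ i) (binom n i) _ ⟨
  binom n i * sumTo (n ℕ.∸ i) (λ j → binom (n ℕ.∸ i) j * binom n (n ℕ.∸ i ℕ.∸ j))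
    ≡⟨ cong (_*_ (binom n i)) (vandermonde (n ℕ.∸ i) n (n ℕ.∸ i)) ⟩
  binom n i * binom (n ℕ.∸ i ℕ.+ n) (n ℕ.∸ i)
    ≡⟨ cong₂ _*_ (binom-symmetric i≤n) (cong (λ m → binom m (n ℕ.∸ i)) (ℕP.+-comm (n ℕ.∸ i) n)) ⟩
  binom n (n ℕ.∸ i) * binom (n ℕ.+ (n ℕ.∸ i)) (n ℕ.∸ i) ∎
  where
  open ≡-Reasoning
  term : ∀ j → j ℕ.≤ n ℕ.∸ i →
    binom n (i ℕ.+ j) * binom n (i ℕ.+ j) * binom (i ℕ.+ j) i
      ≡ binom n i * (binom (n ℕ.∸ i) j * binom n (n ℕ.∸ i ℕ.∸ j))
  term j j≤n∸i = begin
    binom n (i ℕ.+ j) * binom n (i ℕ.+ j) * binom (i ℕ.+ j) i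
      ≡⟨ ℚP.*-assoc (binom n (i ℕ.+ j)) _ _ ⟩
    binom n (i ℕ.+ j) * (binom n (i ℕ.+ j) * binom (i ℕ.+ j) i)
      ≡⟨ cong₂ _*_ (trans (binom-symmetric i+j≤n) (cong (binom n) (sym (ℕP.∸-+-assoc n i j))))
                   (binom-subset-of-subset i j i+j≤n) ⟩
    binom n (n ℕ.∸ i ℕ.∸ j) * (binom n i * binom (n ℕ.∸ i) j)
      ≡⟨ rotate (binom n (n ℕ.∸ i ℕ.∸ j)) (binom n i) (binom (n ℕ.∸ i) j) ⟩
    binom n i * (binom (n ℕ.∸ i) j * binom n (n ℕ.∸ i ℕ.∸ j)) ∎
    where
    i+j≤n = ℕP.≤-trans (ℕP.+-monoʳ-≤ i j≤n∸i) (ℕP.≤-reflexive (ℕP.m+[n∸m]≡n i≤n))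
    rotate : ∀ x y z → x * (y * z) ≡ y * (z * x)
    rotate = solve 3 (λ x y z → x :* (y :* z) := y :* (z :* x)) refl

binomial-transform : ∀ n (f : ℕ → ℚ) →
  sumTo n (λ k → binom n k * binom n k * sumTo k (λ i → binom k i * f i))
    ≡ sumTo n (λ k → binom n k * binom (n ℕ.+ k) k * f (n ℕ.∸ k))
binomial-transform n f = begin
  sumTo n (λ k → binom n k * binom n k * sumTo k (λ i → binom k i * f i))
    ≡⟨ sum-cong n (λ k k≤n → trans (cong (_*_ (binom n k * binom n k)) (sum-binom-extend f k≤n))
                                       (*-distribˡ-sum n (binom n k * binom n k) (λ i → binom k i * f i))) ⟩
  sumTo n (λ k → sumTo n (λ i → binom n k * binom n k * (binom k i * f i)))
    ≡⟨ sum-swap n n _ ⟩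
  sumTo n (λ i → sumTo n (λ k → binom n k * binom n k * (binom k i * f i)))
    ≡⟨ sum-cong n collect ⟩
  sumTo n (λ i → binom n (n ℕ.∸ i) * binom (n ℕ.+ (n ℕ.∸ i)) (n ℕ.∸ i) * f (n ℕ.∸ (n ℕ.∸ i)))
    ≡⟨ sum-reverse n _ ⟨
  sumTo n (λ k → binom n k * binom (n ℕ.+ k) k * f (n ℕ.∸ k)) ∎
  where
  open ≡-Reasoning
  collect : ∀ i → i ℕ.≤ n →
    sumTo n (λ k → binom n k * binom n k * (binom k i * f i))
      ≡ binom n (n ℕ.∸ i) * binom (n ℕ.+ (n ℕ.∸ i)) (n ℕ.∸ i) * f (n ℕ.∸ (n ℕ.∸ i))
  collect i i≤n = begin
    sumTo n (λ k → binom n k * binom n k * (binom k i * f i))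
      ≡⟨ sum-cong n (λ k _ → sym (ℚP.*-assoc (binom n k * binom n k) (binom k i) (f i))) ⟩
    sumTo n (λ k → binom n k * binom n k * binom k i * f i)
      ≡⟨ *-distribʳ-sum n (f i) _ ⟨
    sumTo n (λ k → binom n k * binom n k * binom k i) * f i
      ≡⟨ cong₂ _*_ (sum-binom²-binom i≤n) (cong f (sym (ℕP.m∸[m∸n]≡n i≤n))) ⟩
    binom n (n ℕ.∸ i) * binom (n ℕ.+ (n ℕ.∸ i)) (n ℕ.∸ i) * f (n ℕ.∸ (n ℕ.∸ i)) ∎

-- Powers of a shift relation

module _ (Y : ℤ → ℚ) (a b : ℤ) (c d : ℚ) (shift : ∀ j → c * Y (j ℤ.+ a) ≡ Y j + d * Y (j ℤ.+ b)) where

  binomial-expansion : ∀ k m →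
    c ^ℚ k * Y (a ℤ.* + k ℤ.+ m) ≡ sumTo k (λ i → binom k i * (d ^ℚ i * Y (b ℤ.* + i ℤ.+ m)))
  binomial-expansion zero    m = begin
    1ℚ * Y (a ℤ.* + 0 ℤ.+ m)          ≡⟨ cong (λ t → 1ℚ * Y t) (trans (x*0+m≡m a m) (sym (x*0+m≡m b m))) ⟩
    1ℚ * Y (b ℤ.* + 0 ℤ.+ m)          ≡⟨ cong (1ℚ *_) (ℚP.*-identityˡ (Y (b ℤ.* + 0 ℤ.+ m))) ⟨
    1ℚ * (1ℚ * Y (b ℤ.* + 0 ℤ.+ m))   ∎
    where
    open ≡-Reasoning
    x*0+m≡m : ∀ x m → x ℤ.* + 0 ℤ.+ m ≡ m
    x*0+m≡m = ℤ-Solver.solve-∀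
  binomial-expansion (suc k) m = begin
    c * c ^ℚ k * Y (a ℤ.* + suc k ℤ.+ m)
      ≡⟨ trans (ℚP.*-assoc c (c ^ℚ k) _) (cong (λ t → c * (c ^ℚ k * Y t)) (peel a (+ k) m)) ⟩
    c * (c ^ℚ k * Y (a ℤ.* + k ℤ.+ (m ℤ.+ a)))
      ≡⟨ cong (c *_) (binomial-expansion k (m ℤ.+ a)) ⟩
    c * sumTo k (λ i → binom k i * (d ^ℚ i * Y (b ℤ.* + i ℤ.+ (m ℤ.+ a))))
      ≡⟨ *-distribˡ-sum k c _ ⟩
    sumTo k (λ i → c * (binom k i * (d ^ℚ i * Y (b ℤ.* + i ℤ.+ (m ℤ.+ a)))))
      ≡⟨ sum-cong k (λ i _ → split i) ⟩
    sumTo k (λ i → binom k i * g i + binom k i * g (suc i))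
      ≡⟨ sum-+ k _ _ ⟩
    sumTo k (λ i → binom k i * g i) + sumTo k (λ i → binom k i * g (suc i))
      ≡⟨ cong (_+ sumTo k (λ i → binom k i * g (suc i))) (sum-binom-extend g (ℕP.n≤1+n k)) ⟩
    sumTo (suc k) (λ i → binom k i * g i) + sumTo k (λ i → binom k i * g (suc i))
      ≡⟨ sum-binom-pascal k k g ⟨
    sumTo (suc k) (λ i → binom (suc k) i * g i) ∎
    where
    open ≡-Reasoning
    g : ℕ → ℚ
    g i = d ^ℚ i * Y (b ℤ.* + i ℤ.+ m)
    peel : ∀ a x m → a ℤ.* (+ 1 ℤ.+ x) ℤ.+ m ≡ a ℤ.* x ℤ.+ (m ℤ.+ a)
    peel = ℤ-Solver.solve-∀
    reassoc : ∀ b x m a → b ℤ.* x ℤ.+ (m ℤ.+ a) ≡ b ℤ.* x ℤ.+ m ℤ.+ a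
    reassoc = ℤ-Solver.solve-∀
    unpeel : ∀ b x m → b ℤ.* x ℤ.+ m ℤ.+ b ≡ b ℤ.* (+ 1 ℤ.+ x) ℤ.+ m
    unpeel = ℤ-Solver.solve-∀
    regroup : ∀ c κ δ x → c * (κ * (δ * x)) ≡ κ * (δ * (c * x))
    regroup = solve 4 (λ c κ δ x → c :* (κ :* (δ :* x)) := κ :* (δ :* (c :* x))) refl
    distribute : ∀ κ δ d x y → κ * (δ * (x + d * y)) ≡ κ * (δ * x) + κ * ((d * δ) * y)
    distribute = solve 5 (λ κ δ d x y → κ :* (δ :* (x :+ d :* y)) := κ :* (δ :* x) :+ κ :* ((d :* δ) :* y)) refl
    split : ∀ i → c * (binom k i * (d ^ℚ i * Y (b ℤ.* + i ℤ.+ (m ℤ.+ a)))) ≡ binom k i * g i + binom k i * g (suc i)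
    split i = begin
      c * (binom k i * (d ^ℚ i * Y (b ℤ.* + i ℤ.+ (m ℤ.+ a))))
        ≡⟨ regroup c (binom k i) (d ^ℚ i) _ ⟩
      binom k i * (d ^ℚ i * (c * Y (b ℤ.* + i ℤ.+ (m ℤ.+ a))))
        ≡⟨ cong (λ t → binom k i * (d ^ℚ i * (c * Y t))) (reassoc b (+ i) m a) ⟩
      binom k i * (d ^ℚ i * (c * Y (b ℤ.* + i ℤ.+ m ℤ.+ a)))
        ≡⟨ cong (λ t → binom k i * (d ^ℚ i * t)) (shift (b ℤ.* + i ℤ.+ m)) ⟩
      binom k i * (d ^ℚ i * (Y (b ℤ.* + i ℤ.+ m) + d * Y (b ℤ.* + i ℤ.+ m ℤ.+ b)))
        ≡⟨ distribute (binom k i) (d ^ℚ i) d _ _ ⟩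
      binom k i * g i + binom k i * (d ^ℚ suc i * Y (b ℤ.* + i ℤ.+ m ℤ.+ b))
        ≡⟨ cong (λ t → binom k i * g i + binom k i * (d ^ℚ suc i * Y t)) (unpeel b (+ i) m) ⟩
      binom k i * g i + binom k i * g (suc i) ∎

-- Sequences with the Fibonacci recurrence

private
  negative-index-recurrence : ∀ σ a b → σ ℤ.* + a ≡ ℤ.- σ ℤ.* + b ℤ.+ ℤ.- (ℤ.- σ) ℤ.* + (b ℕ.+ a)
  negative-index-recurrence σ a b = trans (identity σ (+ a) (+ b)) (cong (λ x → ℤ.- σ ℤ.* + b ℤ.+ ℤ.- (ℤ.- σ) ℤ.* x) (sym (ℤP.pos-+ b a)))
    where
    identity : ∀ σ x y → σ ℤ.* x ≡ ℤ.- σ ℤ.* y ℤ.+ ℤ.- (ℤ.- σ) ℤ.* (y ℤ.+ x)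
    identity = ℤ-Solver.solve-∀

F-rec : ∀ z → F (z ℤ.+ + 2) ≡ F (z ℤ.+ + 1) ℤ.+ F z
F-rec (+ n) rewrite ℕP.+-comm n 2 | ℕP.+-comm n 1 = ℤP.pos-+ (fibℕ (suc n)) (fibℕ n)
F-rec -[1+ 0 ]           = refl
F-rec -[1+ 1 ]           = refl
F-rec -[1+ suc (suc n) ] = negative-index-recurrence (signℤ n) (fibℕ (suc n)) (fibℕ (suc (suc n)))

L-rec : ∀ z → L (z ℤ.+ + 2) ≡ L (z ℤ.+ + 1) ℤ.+ L z
L-rec (+ n) rewrite ℕP.+-comm n 2 | ℕP.+-comm n 1 = ℤP.pos-+ (lucℕ (suc n)) (lucℕ n)
L-rec -[1+ 0 ]           = refl
L-rec -[1+ 1 ]           = refl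
L-rec -[1+ suc (suc n) ] = negative-index-recurrence (signℤ (suc n)) (lucℕ (suc n)) (lucℕ (suc (suc n)))

fibℕ-suc-nonzero : ∀ n → fibℕ (suc n) ≢ 0
fibℕ-suc-nonzero zero    ()
fibℕ-suc-nonzero (suc n) eq = fibℕ-suc-nonzero n (ℕP.m+n≡0⇒m≡0 (fibℕ (suc n)) eq)

signℤ-nonzero : ∀ n → signℤ n ≢ + 0
signℤ-nonzero n σ≡0 with trans (sym (signℤ-square n)) (cong (ℤ._* signℤ n) σ≡0)
... | ()

F-nonzero : ∀ r → r ≢ + 0 → F r ≢ + 0
F-nonzero (+ zero)  r≢0 _  = r≢0 refl
F-nonzero +[1+ n ] _   eq = fibℕ-suc-nonzero n (ℤP.+-injective eq)
F-nonzero -[1+ n ] _   eq =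
  [ signℤ-nonzero n , fibℕ-suc-nonzero n ∘ ℤP.+-injective ] (ℤP.i*j≡0⇒i≡0∨j≡0 (signℤ n) eq)

Fℚ-nonzero : ∀ r → r ≢ + 0 → Fℚ r ≢ 0ℚ
Fℚ-nonzero r r≢0 eq = F-nonzero r r≢0 (fromℤ-injective eq)

record IsGibonacci (X : ℤ → ℚ) : Set where
  field
    recurrence : ∀ z → X (z ℤ.+ + 2) ≡ X (z ℤ.+ + 1) + X z

open IsGibonacci using (recurrence)

Fℚ-isGibonacci : IsGibonacci Fℚ
Fℚ-isGibonacci .recurrence z = trans (cong fromℤ (F-rec z)) (fromℤ-homo-+ (F (z ℤ.+ + 1)) (F z))

Lℚ-isGibonacci : IsGibonacci Lℚ
Lℚ-isGibonacci .recurrence z = trans (cong fromℤ (L-rec z)) (fromℤ-homo-+ (L (z ℤ.+ + 1)) (L z))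

ℤ-induction : (P : ℤ → Set) → P (+ 0) → (∀ z → P z → P (z ℤ.+ + 1)) → (∀ z → P (z ℤ.+ + 1) → P z) → ∀ z → P z
ℤ-induction P base up down (+ zero)     = base
ℤ-induction P base up down (+ suc n)    = subst P (cong +_ (ℕP.+-comm n 1)) (up (+ n) (ℤ-induction P base up down (+ n)))
ℤ-induction P base up down -[1+ zero ]  = down -[1+ 0 ] base
ℤ-induction P base up down -[1+ suc n ] = down -[1+ suc n ] (ℤ-induction P base up down -[1+ n ])

private
  z+1+1≡z+2 : ∀ z → z ℤ.+ + 1 ℤ.+ + 1 ≡ z ℤ.+ + 2
  z+1+1≡z+2 z = ℤP.+-assoc z (+ 1) (+ 1)

  recurrence′ : ∀ {X} → IsGibonacci X → ∀ z → X (z ℤ.+ + 1 ℤ.+ + 1) ≡ X (z ℤ.+ + 1) + X z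
  recurrence′ {X} gib z = trans (cong X (z+1+1≡z+2 z)) (recurrence gib z)

module _ {X : ℤ → ℚ} (gib : IsGibonacci X) where

  isGibonacci-shift : ∀ c → IsGibonacci (λ z → X (z ℤ.+ c))
  isGibonacci-shift c .recurrence z = begin
    X (z ℤ.+ + 2 ℤ.+ c)                      ≡⟨ cong X (swap z (+ 2) c) ⟩
    X (z ℤ.+ c ℤ.+ + 2)                      ≡⟨ recurrence gib (z ℤ.+ c) ⟩
    X (z ℤ.+ c ℤ.+ + 1) + X (z ℤ.+ c)        ≡⟨ cong (λ w → X w + X (z ℤ.+ c)) (swap z c (+ 1)) ⟩
    X (z ℤ.+ + 1 ℤ.+ c) + X (z ℤ.+ c)        ∎
    where
    open ≡-Reasoning
    swap : ∀ x y w → x ℤ.+ y ℤ.+ w ≡ x ℤ.+ w ℤ.+ y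
    swap = ℤ-Solver.solve-∀

  isGibonacci-scale : ∀ a → IsGibonacci (λ z → a * X z)
  isGibonacci-scale a .recurrence z = trans (cong (a *_) (recurrence gib z)) (ℚP.*-distribˡ-+ a (X (z ℤ.+ + 1)) (X z))

  isGibonacci-+ : ∀ {Y} → IsGibonacci Y → IsGibonacci (λ z → X z + Y z)
  isGibonacci-+ {Y} gibY .recurrence z = trans (cong₂ _+_ (recurrence gib z) (recurrence gibY z)) (+-interchange (X (z ℤ.+ + 1)) (X z) (Y (z ℤ.+ + 1)) (Y z))

  isGibonacci-unique : ∀ {Y} → IsGibonacci Y → X (+ 0) ≡ Y (+ 0) → X (+ 1) ≡ Y (+ 1) → ∀ z → X z ≡ Y z
  isGibonacci-unique {Y} gibY eq₀ eq₁ z = proj₁ (ℤ-induction P (eq₀ , eq₁) up down z)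
    where
    P : ℤ → Set
    P z = X z ≡ Y z × X (z ℤ.+ + 1) ≡ Y (z ℤ.+ + 1)
    up : ∀ z → P z → P (z ℤ.+ + 1)
    up z (eqz , eqz+1) =
      eqz+1 , trans (recurrence′ gib z) (trans (cong₂ _+_ eqz+1 eqz) (sym (recurrence′ gibY z)))
    down : ∀ z → P (z ℤ.+ + 1) → P z
    down z (eqz+1 , eqz+2) =
      +-cancelˡ (X (z ℤ.+ + 1)) (X z) (Y z)
        (trans (sym (recurrence′ gib z)) (trans eqz+2 (trans (recurrence′ gibY z) (cong (_+ Y z) (sym eqz+1))))) ,
      eqz+1

private
  a-b-c≡0⇒a≡b+c : ∀ {a b c} → a ℚ.- b ℚ.- c ≡ 0ℚ → a ≡ b + c
  a-b-c≡0⇒a≡b+c {a} {b} {c} eq = trans (split a b c) (trans (cong (_+ (b + c)) eq) (ℚP.+-identityˡ (b + c)))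
    where
    split : ∀ a b c → a ≡ (a ℚ.- b ℚ.- c) + (b + c)
    split = solve 3 (λ a b c → a := (a :- b :- c) :+ (b :+ c)) refl

alternating-zero : (W : ℤ → ℚ) → W (+ 0) ≡ 0ℚ → (∀ z → W (z ℤ.+ + 1) ≡ - W z) → ∀ z → W z ≡ 0ℚ
alternating-zero W W₀ flip = ℤ-induction (λ z → W z ≡ 0ℚ) W₀
  (λ z Wz≡0 → trans (flip z) (cong -_ Wz≡0))
  (λ z Wz+1≡0 → trans (sym (neg-involutive (W z))) (trans (cong -_ (sym (flip z))) (cong -_ Wz+1≡0)))

module _ {X : ℤ → ℚ} (gib : IsGibonacci X) where

  vajda₁ : ∀ j s → X (j ℤ.+ s) * Fℚ (s ℤ.+ + 1) ≡ Fℚ s * X (j ℤ.+ s ℤ.+ + 1) + negOnePow s * X j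
  vajda₁ j s = a-b-c≡0⇒a≡b+c (alternating-zero defect defect₀ defect-flip s)
    where
    defect : ℤ → ℚ
    defect s = X (j ℤ.+ s) * Fℚ (s ℤ.+ + 1) ℚ.- Fℚ s * X (j ℤ.+ s ℤ.+ + 1) ℚ.- negOnePow s * X j
    defect₀ : defect (+ 0) ≡ 0ℚ
    defect₀ rewrite ℤP.+-identityʳ j = cancel (X j) (X (j ℤ.+ + 1))
      where
      cancel : ∀ x y → x * 1ℚ ℚ.- 0ℚ * y ℚ.- 1ℚ * x ≡ 0ℚ
      cancel = solve 2 (λ x y → x :* con 1ℚ :- con 0ℚ :* y :- con 1ℚ :* x := con 0ℚ) refl
    defect-flip : ∀ s → defect (s ℤ.+ + 1) ≡ - defect s
    defect-flip s
      rewrite sym (ℤP.+-assoc j s (+ 1)) | z+1+1≡z+2 s | z+1+1≡z+2 (j ℤ.+ s)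
            | recurrence Fℚ-isGibonacci s | recurrence gib (j ℤ.+ s) | negOnePow-suc s
      = flip (Fℚ (s ℤ.+ + 1)) (Fℚ s) (X (j ℤ.+ s ℤ.+ + 1)) (X (j ℤ.+ s)) (negOnePow s) (X j)
      where
      flip : ∀ f₁ f₀ x₁ x₀ σ y →
        x₁ * (f₁ + f₀) ℚ.- f₁ * (x₁ + x₀) ℚ.- (- σ) * y ≡ - (x₀ * f₁ ℚ.- f₀ * x₁ ℚ.- σ * y)
      flip = solve 6 (λ f₁ f₀ x₁ x₀ σ y →
        x₁ :* (f₁ :+ f₀) :- f₁ :* (x₁ :+ x₀) :- (:- σ) :* y := :- (x₀ :* f₁ :- f₀ :* x₁ :- σ :* y)) refl

  vajda : ∀ j s r → X (j ℤ.+ s) * Fℚ (r ℤ.+ s) ≡ Fℚ s * X (r ℤ.+ (j ℤ.+ s)) + negOnePow s * X j * Fℚ r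
  vajda j s = isGibonacci-unique lhs-isGibonacci rhs-isGibonacci at-0 at-1
    where
    lhs-isGibonacci : IsGibonacci (λ r → X (j ℤ.+ s) * Fℚ (r ℤ.+ s))
    lhs-isGibonacci = isGibonacci-scale (isGibonacci-shift Fℚ-isGibonacci s) (X (j ℤ.+ s))
    rhs-isGibonacci : IsGibonacci (λ r → Fℚ s * X (r ℤ.+ (j ℤ.+ s)) + negOnePow s * X j * Fℚ r)
    rhs-isGibonacci = isGibonacci-+ (isGibonacci-scale (isGibonacci-shift gib (j ℤ.+ s)) (Fℚ s))
                                    (isGibonacci-scale Fℚ-isGibonacci (negOnePow s * X j))
    at-0 : X (j ℤ.+ s) * Fℚ (+ 0 ℤ.+ s) ≡ Fℚ s * X (+ 0 ℤ.+ (j ℤ.+ s)) + negOnePow s * X j * Fℚ (+ 0)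
    at-0 rewrite ℤP.+-identityˡ s | ℤP.+-identityˡ (j ℤ.+ s) = commute (X (j ℤ.+ s)) (Fℚ s) (negOnePow s * X j)
      where
      commute : ∀ x f y → x * f ≡ f * x + y * 0ℚ
      commute = solve 3 (λ x f y → x :* f := f :* x :+ y :* con 0ℚ) refl
    at-1 : X (j ℤ.+ s) * Fℚ (+ 1 ℤ.+ s) ≡ Fℚ s * X (+ 1 ℤ.+ (j ℤ.+ s)) + negOnePow s * X j * Fℚ (+ 1)
    at-1 rewrite ℤP.+-comm (+ 1) s | ℤP.+-comm (+ 1) (j ℤ.+ s) | ℚP.*-identityʳ (negOnePow s * X j) = vajda₁ j s

module _ {X : ℤ → ℚ} (gib : IsGibonacci X) (r s : ℤ) (Fr≢0 : Fℚ r ≢ 0ℚ) where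

  shift-relation : ∀ j →
    negOnePow (s ℤ.+ + 1) * (Fℚ s /ℚ Fℚ r) * X (j ℤ.+ (r ℤ.+ s))
      ≡ X j + negOnePow (s ℤ.+ + 1) * (Fℚ (r ℤ.+ s) /ℚ Fℚ r) * X (j ℤ.+ s)
  shift-relation j = begin
    negOnePow (s ℤ.+ + 1) * (Fℚ s /ℚ Fℚ r) * X (j ℤ.+ (r ℤ.+ s))
      ≡⟨ cong₂ (λ τ u → τ * u * X (j ℤ.+ (r ℤ.+ s))) (negOnePow-suc s) (/ℚ-as-* (Fℚ s) (Fℚ r) Fr≢0) ⟩
    - negOnePow s * (Fℚ s * (1ℚ /ℚ Fℚ r)) * X (j ℤ.+ (r ℤ.+ s))
      ≡⟨ rearrange (X j) (X (j ℤ.+ (r ℤ.+ s))) (X (j ℤ.+ s)) (Fℚ s) (Fℚ r) (Fℚ (r ℤ.+ s)) (negOnePow s) (1ℚ /ℚ Fℚ r)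
                 (negOnePow-square s) (1/ℚ-inverseˡ (Fℚ r) Fr≢0)
                 (trans (vajda gib j s r) (cong (λ t → Fℚ s * X t + negOnePow s * X j * Fℚ r) (reassoc r j s))) ⟩
    X j + - negOnePow s * (Fℚ (r ℤ.+ s) * (1ℚ /ℚ Fℚ r)) * X (j ℤ.+ s)
      ≡⟨ cong₂ (λ τ w → X j + τ * w * X (j ℤ.+ s)) (negOnePow-suc s) (/ℚ-as-* (Fℚ (r ℤ.+ s)) (Fℚ r) Fr≢0) ⟨
    X j + negOnePow (s ℤ.+ + 1) * (Fℚ (r ℤ.+ s) /ℚ Fℚ r) * X (j ℤ.+ s) ∎
    where
    open ≡-Reasoning
    reassoc : ∀ r j s → r ℤ.+ (j ℤ.+ s) ≡ j ℤ.+ (r ℤ.+ s)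
    reassoc = ℤ-Solver.solve-∀
    -- Vajda's identity multiplied by -(-1)^s / F_r.
    rearrange : ∀ x y z f g h σ ρ → σ * σ ≡ 1ℚ → ρ * g ≡ 1ℚ → z * h ≡ f * y + σ * x * g →
      - σ * (f * ρ) * y ≡ x + - σ * (h * ρ) * z
    rearrange x y z f g h σ ρ σ²≡1 ρg≡1 zh≡fy+σxg = begin
      - σ * (f * ρ) * y
        ≡⟨ expand x y f g σ ρ ⟩
      x * ((σ * σ) * (ρ * g) ℚ.- 1ℚ) + (x + - σ * ρ * (f * y + σ * x * g))
        ≡⟨ cong₂ (λ a b → x * (a * b ℚ.- 1ℚ) + (x + - σ * ρ * (f * y + σ * x * g))) σ²≡1 ρg≡1 ⟩
      x * (1ℚ * 1ℚ ℚ.- 1ℚ) + (x + - σ * ρ * (f * y + σ * x * g))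
        ≡⟨ cong (λ c → x * (1ℚ * 1ℚ ℚ.- 1ℚ) + (x + - σ * ρ * c)) zh≡fy+σxg ⟨
      x * (1ℚ * 1ℚ ℚ.- 1ℚ) + (x + - σ * ρ * (z * h))
        ≡⟨ collapse x z h σ ρ ⟩
      x + - σ * (h * ρ) * z ∎
      where
      open ≡-Reasoning
      expand : ∀ x y f g σ ρ → - σ * (f * ρ) * y ≡ x * ((σ * σ) * (ρ * g) ℚ.- 1ℚ) + (x + - σ * ρ * (f * y + σ * x * g))
      expand = solve 6 (λ x y f g σ ρ →
        :- σ :* (f :* ρ) :* y := x :* ((σ :* σ) :* (ρ :* g) :- con 1ℚ) :+ (x :+ :- σ :* ρ :* (f :* y :+ σ :* x :* g))) refl
      collapse : ∀ x z h σ ρ → x * (1ℚ * 1ℚ ℚ.- 1ℚ) + (x + - σ * ρ * (z * h)) ≡ x + - σ * (h * ρ) * z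
      collapse = solve 5 (λ x z h σ ρ →
        x :* (con 1ℚ :* con 1ℚ :- con 1ℚ) :+ (x :+ :- σ :* ρ :* (z :* h)) := x :+ :- σ :* (h :* ρ) :* z) refl

sign-into-power : ∀ k z A p x → negOnePow (+ k ℤ.* z) * A * p ^ℚ k * x ≡ A * ((negOnePow z * p) ^ℚ k * x)
sign-into-power k z A p x = begin
  negOnePow (+ k ℤ.* z) * A * p ^ℚ k * x          ≡⟨ cong (λ σ → σ * A * p ^ℚ k * x) (negOnePow-* k z) ⟩
  negOnePow z ^ℚ k * A * p ^ℚ k * x               ≡⟨ regroup (negOnePow z ^ℚ k) A (p ^ℚ k) x ⟩
  A * ((negOnePow z ^ℚ k * p ^ℚ k) * x)           ≡⟨ cong (λ t → A * (t * x)) (^ℚ-distrib-* (negOnePow z) p k) ⟨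
  A * ((negOnePow z * p) ^ℚ k * x)                ∎
  where
  open ≡-Reasoning
  regroup : ∀ σ A q x → σ * A * q * x ≡ A * ((σ * q) * x)
  regroup = solve 4 (λ σ A q x → σ :* A :* q :* x := A :* ((σ :* q) :* x)) refl

gibonacci-identity : ∀ {X} → IsGibonacci X → ∀ r s m → Fℚ r ≢ 0ℚ → ∀ n → lhs X r s m n ≡ rhs X r s m n
gibonacci-identity {X} gib r s m Fr≢0 n = begin
  lhs X r s m n
    ≡⟨ sum-cong n (λ k _ → sign-into-power k (s ℤ.+ + 1) (binom n k * binom n k) (Fℚ s /ℚ Fℚ r) _) ⟩
  sumTo n (λ k → binom n k * binom n k * (c ^ℚ k * X ((r ℤ.+ s) ℤ.* + k ℤ.+ m)))
    ≡⟨ sum-cong n (λ k _ → cong (binom n k * binom n k *_)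
         (binomial-expansion X (r ℤ.+ s) s c d (shift-relation gib r s Fr≢0) k m)) ⟩
  sumTo n (λ k → binom n k * binom n k * sumTo k (λ i → binom k i * (d ^ℚ i * X (s ℤ.* + i ℤ.+ m))))
    ≡⟨ binomial-transform n (λ i → d ^ℚ i * X (s ℤ.* + i ℤ.+ m)) ⟩
  sumTo n (λ k → binom n k * binom (n ℕ.+ k) k * (d ^ℚ (n ℕ.∸ k) * X (s ℤ.* + (n ℕ.∸ k) ℤ.+ m)))
    ≡⟨ sum-cong n (λ k _ → rhs-term k) ⟨
  rhs X r s m n ∎
  where
  open ≡-Reasoning
  c d : ℚ
  c = negOnePow (s ℤ.+ + 1) * (Fℚ s /ℚ Fℚ r)
  d = negOnePow (s ℤ.+ + 1) * (Fℚ (r ℤ.+ s) /ℚ Fℚ r)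
  rhs-term : ∀ k →
    negOnePow ((s ℤ.+ + 1) ℤ.* + (n ℕ.∸ k)) * (binom n k * binom (n ℕ.+ k) k)
      * (Fℚ (r ℤ.+ s) /ℚ Fℚ r) ^ℚ (n ℕ.∸ k) * X (s ℤ.* + (n ℕ.∸ k) ℤ.+ m)
    ≡ binom n k * binom (n ℕ.+ k) k * (d ^ℚ (n ℕ.∸ k) * X (s ℤ.* + (n ℕ.∸ k) ℤ.+ m))
  rhs-term k rewrite ℤP.*-comm (s ℤ.+ + 1) (+ (n ℕ.∸ k)) =
    sign-into-power (n ℕ.∸ k) (s ℤ.+ + 1) (binom n k * binom (n ℕ.+ k) k) (Fℚ (r ℤ.+ s) /ℚ Fℚ r) _

theorem32 : (r s m : ℤ) → r ≢ + 0 → (n : ℕ) →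
    (lhs Fℚ r s m n ≡ rhs Fℚ r s m n) × (lhs Lℚ r s m n ≡ rhs Lℚ r s m n)
theorem32 r s m r≢0 n =
  gibonacci-identity Fℚ-isGibonacci r s m (Fℚ-nonzero r r≢0) n ,
  gibonacci-identity Lℚ-isGibonacci r s m (Fℚ-nonzero r r≢0) n
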